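{- Let $(S_0,F_0),\ldots,(S_n,F_n)$ be an evolution of $t$-societies (as defined in the context). If $X\in S_{n-1}$, then $|X|\ge (n-2)/(4t)$.
   Context: Let $P$ be a finite poset. A First-Fit chain partition of $P$ is an ordered partition $C_1,\ldots,C_m$ of $P$ into non-empty chains such that whenever $i<j$ and $x\in C_j$, some element of $C_i$ is incomparable to $x$. Fix such a partition and set $C_j=\emptyset$ for $j>m$. A group is a subset of $P$. For a positive integer $t$, a $t$-society is a pair $(S,F)$ where $S$ is a set of groups and $F: S\times\{1,\ldots,t\}\to S\cup\{\star\}$ is a function; $X$ lists $Y$ as a friend in slot $k$ if $F(X,k)=Y$. Let $\varepsilon=1/(2t)$. An evolution is a sequence $(S_0,F_0),\ldots,(S_n,F_n)$ of $t$-societies with $(S_0,F_0)$ arbitrary, $S_n=\emptyset$, and for each $1\le j\le n$: $S_j$ consists exactly of those $X\in S_{j-1}$ satisfying one of the following, and the type of the transition of $X$ from $S_{j-1}$ to $S_j$ is the first rule that applies: ($\alpha$) $X\cap C_j\neq\emptyset$; ($\beta$) otherwise, some friend $F_{j-1}(X,k)\neq\star$ of $X$ in $(S_{j-1},F_{j-1})$ satisfies $F_{j-1}(X,k)\cap C_j\neq\emptyset$; ($\gamma$) otherwise, there is an integer $i$ with $0\le i\le j-1$ and $N^{\alpha}_{i,j-1}(X)>\varepsilon(j-i)$. Here, for $i\le j$ and $a\in\{\alpha,\beta,\gamma\}$, $N^a_{i,j}(X)$ is the number of indices $l$ with $i<l\le j$ such that $X\in S_l$ and $X$ makes a transition of type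 $a$ from $S_{l-1}$ to $S_l$. Friendships are permanent: if $F_{j-1}(X,k)=Y$ and $X,Y\in S_j$, then $F_j(X,k)=Y$; otherwise $F_j(X,k)$ may be any element of $S_j\cup\{\star\}$. -}

module Defs where

open import Level using (0ℓ)
open import Data.Nat using (ℕ; zero; suc; _+_; _*_; _∸_; _≤_; _<_; _≤?_)
open import Data.Fin using (Fin)
open import Data.Fin.Subset using (Subset; _∈_; _∩_; Nonempty; ⊥)
open import Data.Fin.Subset.Properties using (nonempty?)
open import Data.Bool using (Bool; true; false; _∧_; if_then_else_)
open import Data.Maybe using (Maybe; just; nothing)
open import Data.Product using (_×_; ∃; Σ)
open import Data.Sum using (_⊎_)
open import Relation.Binary using (Rel; IsPartialOrder)
open import Relation.Binary.PropositionalEquality using (_≡_)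
open import Relation.Nullary using (¬_; does)

-- The finite poset P is (Fin N, _≼_) with _≼_ a partial order.
-- Groups are subsets of P, i.e. elements of Subset N.

module _ {N : ℕ} (_≼_ : Rel (Fin N) 0ℓ) where

  Comparable : Fin N → Fin N → Set
  Comparable x y = (x ≼ y) ⊎ (y ≼ x)

  IsChain : Subset N → Set
  IsChain A = ∀ x y → x ∈ A → y ∈ A → Comparable x y

  -- A First-Fit chain partition C_1,…,C_m, extended by C_j = ∅ for j > m.
  -- The index 0 is unused; we set C_0 = ∅ as a convention.
  record FirstFitPartition : Set where
    field
      m          : ℕ
      C          : ℕ → Subset N
      C-zero     : C 0 ≡ ⊥
      C-beyond   : ∀ j → m < j → C j ≡ ⊥
      C-nonempty : ∀ j → 1 ≤ j → j ≤ m → Nonempty (C j)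
      C-chain    : ∀ j → IsChain (C j)
      C-cover    : ∀ x → ∃ λ j → x ∈ C j
      C-disjoint : ∀ x j j′ → x ∈ C j → x ∈ C j′ → j ≡ j′
      C-firstFit : ∀ i j x → 1 ≤ i → i < j → x ∈ C j →
                   ∃ λ y → (y ∈ C i) × ¬ Comparable x y

Meets : {N : ℕ} → Subset N → Subset N → Set
Meets X Y = Nonempty (X ∩ Y)

meets? : {N : ℕ} → Subset N → Subset N → Bool
meets? X Y = does (nonempty? (X ∩ Y))

-- count p i j = number of l with i < l ≤ j and p l ≡ true
count : (ℕ → Bool) → ℕ → ℕ → ℕ
count p i zero    = 0
count p i (suc j) = count p i j + (if does (i ≤? j) then (if p (suc j) then 1 else 0) else 0)

-- A sequence of sets of groups is given by membership predicates
-- S j : Subset N → Bool (a set of groups is a subset of the finite power set).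
-- Friend functions F j X k : Maybe (Subset N), with nothing standing for ⋆.

-- N^α_{i,j}(X): number of l with i < l ≤ j, X ∈ S_l and X makes a type-α
-- transition at l (i.e. X ∩ C_l ≠ ∅; α is the first rule, so this is exactly type α).
Nα : {N : ℕ} → (ℕ → Subset N → Bool) → (ℕ → Subset N) → Subset N → ℕ → ℕ → ℕ
Nα S C X i j = count (λ l → S l X ∧ meets? X (C l)) i j

IsSociety : {N t : ℕ} → (Subset N → Bool) → (Subset N → Fin t → Maybe (Subset N)) → Set
IsSociety {N} {t} S F = ∀ (X : Subset N) (k : Fin t) (Y : Subset N) →
  S X ≡ true → F X k ≡ just Y → S Y ≡ true

-- Transition rule for X from S_j to S_{j+1} (i.e. index j+1 in the paper),
-- with ε = 1/(2t): N^α_{i,j}(X) > (j+1-i)/(2t)  ⇔  (j+1-i) < 2t·N^α_{i,j}(X).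
SurvivesTo : {N t : ℕ} → (ℕ → Subset N → Bool) → (ℕ → Subset N → Fin t → Maybe (Subset N)) →
             (ℕ → Subset N) → Subset N → ℕ → Set
SurvivesTo {N} {t} S F C X j =
  (S j X ≡ true) ×
  ( Meets X (C (suc j))
  ⊎ (∃ λ (k : Fin t) → ∃ λ (Y : Subset N) → (F j X k ≡ just Y) × Meets Y (C (suc j)))
  ⊎ (∃ λ (i : ℕ) → (i ≤ j) × (suc j ∸ i < 2 * t * Nα S C X i j)))

record Evolution {N : ℕ} (t : ℕ) (C : ℕ → Subset N) (n : ℕ) : Set where
  field
    S : ℕ → Subset N → Bool
    F : ℕ → Subset N → Fin t → Maybe (Subset N)
    society   : ∀ j → j ≤ n → IsSociety (S j) (F j)
    last-empty : ∀ X → S n X ≡ false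
    step      : ∀ j → suc j ≤ n → ∀ X →
                (S (suc j) X ≡ true → SurvivesTo S F C X j) ×
                (SurvivesTo S F C X j → S (suc j) X ≡ true)
    permanent : ∀ j → suc j ≤ n → ∀ X k Y → F j X k ≡ just Y →
                S (suc j) X ≡ true → S (suc j) Y ≡ true → F (suc j) X k ≡ just Y

-- Let X ∈ S_m with n = m + 1, and say that step l is a hit of slot k when the friend
-- of X in slot k at time l - 1 meets C_l. The potential P(j) = 2t·N^α_{0,j}(X) + Σ_k hits_k(j)
-- pays for every step survived: α- and β-steps raise it, and a γ-step at time j+1 with
-- witness i is covered by the α-steps made since i; hence m ≤ P(m).
-- The hits through a slot are charged to the α-steps of the friend sitting in it; every friend
-- eventually drops out (S_n = ∅) without a γ-step, which gives 2t·hits_k(m) ≤ m + 1. As the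
-- chains are disjoint, N^α_{0,m}(X) ≤ |X|, and together m ≤ 4t·|X| + 1.

module Submission where

open import Defs
open import Level using (0ℓ)
open import Data.Nat using (ℕ; zero; suc; _+_; _*_; _∸_; _≤_; _<_; _≤?_; z≤n; s≤s; >-nonZero)
open import Data.Nat.Properties
open import Data.Nat.Induction using (<-rec)
open import Data.Nat.Tactic.RingSolver using (solve)
open import Data.List using ([]; _∷_)
open import Data.Fin using (Fin)
import Data.Fin as Fin
open import Data.Fin.Subset using (Subset; ∣_∣; _∈_; _∉_; _∩_; _∪_; _⊆_; _⊂_; ⊥)
open import Data.Fin.Subset.Properties using (p⊂q⇒∣p∣<∣q∣; p⊆q⇒∣p∣≤∣q∣; x∈p∩q⁺; x∈p∩q⁻; x∈p∪q⁺; x∈p∪q⁻; ∉⊥; nonempty?; p∩q⊆p)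
open import Algebra.Properties.CommutativeSemigroup +-commutativeSemigroup using (xy∙z≈xz∙y; x∙yz≈y∙xz)
open import Algebra.Properties.Semiring.Sum +-*-semiring using (sum; *-distribˡ-sum)
open import Data.Bool using (Bool; true; false; _∧_)
open import Data.Maybe using (Maybe; just; nothing; maybe′)
open import Data.Product using (_×_; _,_; proj₁; proj₂; ∃)
open import Data.Sum using (_⊎_; inj₁; inj₂)
open import Data.Empty using (⊥-elim)
open import Function using (case_of_)
open import Relation.Binary using (Rel; IsPartialOrder)
open import Relation.Binary.PropositionalEquality using (_≡_; refl; sym; trans; cong; cong₂; subst; module ≡-Reasoning)
open import Relation.Nullary using (¬_; Dec; does; yes; no)
open import Relation.Nullary.Decidable using (dec-true; dec-false)

count-suc-true : ∀ p {i j} → i ≤ j → p (suc j) ≡ true → count p i (suc j) ≡ suc (count p i j)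
count-suc-true p {i} {j} i≤j pj rewrite dec-true (i ≤? j) i≤j | pj = +-comm (count p i j) 1

count-suc-false : ∀ p {i} j → p (suc j) ≡ false → count p i (suc j) ≡ count p i j
count-suc-false p {i} j pj with does (i ≤? j)
... | false = +-identityʳ _
... | true rewrite pj = +-identityʳ _

count-empty : ∀ p {i} j → j ≤ i → count p i j ≡ 0
count-empty p zero j≤i = refl
count-empty p {i} (suc j) j<i
  rewrite dec-false (i ≤? j) (<⇒≱ j<i) | count-empty p j (<⇒≤ j<i) = refl

count-≤-suc : ∀ p i j → count p i j ≤ count p i (suc j)
count-≤-suc p i j = m≤m+n _ _

count-monoʳ : ∀ p i {j j′} → j ≤ j′ → count p i j ≤ count p i j′
count-monoʳ p i {j′ = zero} z≤n = ≤-refl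
count-monoʳ p i {j} {suc j′} j≤1+j′ with m≤n⇒m<n∨m≡n j≤1+j′
... | inj₂ refl = ≤-refl
... | inj₁ (s≤s j≤j′) = ≤-trans (count-monoʳ p i j≤j′) (count-≤-suc p i j′)

count-suc : ∀ p {i j} → i ≤ j → count p i (suc j) ≡ count p i j + count p j (suc j)
count-suc p {i} {j} i≤j
  rewrite dec-true (i ≤? j) i≤j | dec-true (j ≤? j) ≤-refl | count-empty p j (≤-refl {j}) = refl

count-split : ∀ p {k i j} → k ≤ i → i ≤ j → count p k j ≡ count p k i + count p i j
count-split p {i = zero} z≤n z≤n = refl
count-split p {k} {i} {suc j} k≤i i≤1+j with m≤n⇒m<n∨m≡n i≤1+j
... | inj₂ refl =
  sym (trans (cong (count p k (suc j) +_) (count-empty p (suc j) ≤-refl)) (+-identityʳ _))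
... | inj₁ (s≤s i≤j) = begin
  count p k (suc j)                             ≡⟨ count-suc p (≤-trans k≤i i≤j) ⟩
  count p k j + δ                               ≡⟨ cong (_+ δ) (count-split p k≤i i≤j) ⟩
  count p k i + count p i j + δ                 ≡⟨ +-assoc (count p k i) (count p i j) δ ⟩
  count p k i + (count p i j + δ)               ≡⟨ cong (count p k i +_) (sym (count-suc p i≤j)) ⟩
  count p k i + count p i (suc j)               ∎
  where
  open ≡-Reasoning
  δ = count p j (suc j)

count-mono-⊆ : ∀ p q i j → (∀ l → p l ≡ true → q l ≡ true) → count p i j ≤ count q i j
count-mono-⊆ p q i zero p⊆q = ≤-refl
count-mono-⊆ p q i (suc j) p⊆q with does (i ≤? j)
... | false = +-monoˡ-≤ 0 (count-mono-⊆ p q i j p⊆q)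
... | true with p (suc j) in pj
...   | false = +-mono-≤ (count-mono-⊆ p q i j p⊆q) z≤n
...   | true rewrite p⊆q (suc j) pj = +-monoˡ-≤ 1 (count-mono-⊆ p q i j p⊆q)

sum-mono-≤ : ∀ {t} {f g : Fin t → ℕ} → (∀ k → f k ≤ g k) → sum f ≤ sum g
sum-mono-≤ {zero} f≤g = z≤n
sum-mono-≤ {suc t} f≤g = +-mono-≤ (f≤g Fin.zero) (sum-mono-≤ (λ k → f≤g (Fin.suc k)))

sum-mono-< : ∀ {t} {f g : Fin t → ℕ} → (∀ k → f k ≤ g k) → ∀ k → f k < g k → sum f < sum g
sum-mono-< {suc t} f≤g Fin.zero fk<gk = +-mono-<-≤ fk<gk (sum-mono-≤ (λ k → f≤g (Fin.suc k)))
sum-mono-< {suc t} f≤g (Fin.suc k) fk<gk =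
  +-mono-≤-< (f≤g Fin.zero) (sum-mono-< (λ k → f≤g (Fin.suc k)) k fk<gk)

sum-≤-const : ∀ {t} {f : Fin t → ℕ} b → (∀ k → f k ≤ b) → sum f ≤ t * b
sum-≤-const {zero} b f≤b = z≤n
sum-≤-const {suc t} b f≤b = +-mono-≤ (f≤b Fin.zero) (sum-≤-const b (λ k → f≤b (Fin.suc k)))

module _ {N : ℕ} (C : ℕ → Subset N)
         (C-disjoint : ∀ x j j′ → x ∈ C j → x ∈ C j′ → j ≡ j′) (X : Subset N) where

  meetsX : ℕ → Bool
  meetsX l = meets? X (C l)

  unionUpTo : ℕ → Subset N
  unionUpTo zero    = ⊥
  unionUpTo (suc j) = unionUpTo j ∪ C (suc j)

  ∈-unionUpTo : ∀ {x} j → x ∈ unionUpTo j → ∃ λ l → l ≤ j × x ∈ C l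
  ∈-unionUpTo zero x∈ = ⊥-elim (∉⊥ x∈)
  ∈-unionUpTo (suc j) x∈ with x∈p∪q⁻ (unionUpTo j) (C (suc j)) x∈
  ... | inj₁ x∈U = let (l , l≤j , x∈Cₗ) = ∈-unionUpTo j x∈U in l , m≤n⇒m≤1+n l≤j , x∈Cₗ
  ... | inj₂ x∈C = suc j , ≤-refl , x∈C

  ∩-unionUpTo-⊆-suc : ∀ j → X ∩ unionUpTo j ⊆ X ∩ unionUpTo (suc j)
  ∩-unionUpTo-⊆-suc j x∈ = let (x∈X , x∈U) = x∈p∩q⁻ X (unionUpTo j) x∈ in
    x∈p∩q⁺ (x∈X , x∈p∪q⁺ (inj₁ x∈U))

  ∩-unionUpTo-⊂-suc : ∀ j → Meets X (C (suc j)) → X ∩ unionUpTo j ⊂ X ∩ unionUpTo (suc j)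
  ∩-unionUpTo-⊂-suc j (x , x∈X∩C) =
    ∩-unionUpTo-⊆-suc j , x , x∈p∩q⁺ (x∈X , x∈p∪q⁺ (inj₂ x∈C)) , x∉
    where
    x∈X = proj₁ (x∈p∩q⁻ X (C (suc j)) x∈X∩C)
    x∈C = proj₂ (x∈p∩q⁻ X (C (suc j)) x∈X∩C)
    x∉ : x ∉ X ∩ unionUpTo j
    x∉ x∈ = let (l , l≤j , x∈Cₗ) = ∈-unionUpTo j (proj₂ (x∈p∩q⁻ X (unionUpTo j) x∈)) in
      <-irrefl refl (subst (_≤ j) (C-disjoint x l (suc j) x∈Cₗ x∈C) l≤j)

  count-meetsX≤∣∩unionUpTo∣ : ∀ j → count meetsX 0 j ≤ ∣ X ∩ unionUpTo j ∣
  count-meetsX≤∣∩unionUpTo∣ zero = z≤n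
  count-meetsX≤∣∩unionUpTo∣ (suc j) = by-cases (nonempty? (X ∩ C (suc j)))
    where
    open ≤-Reasoning
    by-cases : Dec (Meets X (C (suc j))) →
               count meetsX 0 (suc j) ≤ ∣ X ∩ unionUpTo (suc j) ∣
    by-cases (yes meets) = begin
      count meetsX 0 (suc j)     ≡⟨ count-suc-true meetsX {j = j} z≤n (dec-true (nonempty? _) meets) ⟩
      suc (count meetsX 0 j)     ≤⟨ s≤s (count-meetsX≤∣∩unionUpTo∣ j) ⟩
      suc ∣ X ∩ unionUpTo j ∣    ≤⟨ p⊂q⇒∣p∣<∣q∣ (∩-unionUpTo-⊂-suc j meets) ⟩
      ∣ X ∩ unionUpTo (suc j) ∣  ∎
    by-cases (no ¬meets) = begin
      count meetsX 0 (suc j)     ≡⟨ count-suc-false meetsX j (dec-false (nonempty? _) ¬meets) ⟩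
      count meetsX 0 j           ≤⟨ count-meetsX≤∣∩unionUpTo∣ j ⟩
      ∣ X ∩ unionUpTo j ∣        ≤⟨ p⊆q⇒∣p∣≤∣q∣ (∩-unionUpTo-⊆-suc j) ⟩
      ∣ X ∩ unionUpTo (suc j) ∣  ∎

  Nα≤∣∣ : ∀ (S : ℕ → Subset N → Bool) j → Nα S C X 0 j ≤ ∣ X ∣
  Nα≤∣∣ S j = begin
    Nα S C X 0 j         ≤⟨ count-mono-⊆ _ meetsX 0 j (λ l → ∧-true-r (S l X)) ⟩
    count meetsX 0 j     ≤⟨ count-meetsX≤∣∩unionUpTo∣ j ⟩
    ∣ X ∩ unionUpTo j ∣  ≤⟨ p⊆q⇒∣p∣≤∣q∣ (p∩q⊆p X (unionUpTo j)) ⟩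
    ∣ X ∣                ∎
    where
    open ≤-Reasoning
    ∧-true-r : ∀ a {b} → a ∧ b ≡ true → b ≡ true
    ∧-true-r true eq = eq

≤-absorb-half : ∀ {t a b m} → 1 ≤ t → m ≤ 2 * t * a + b → 2 * t * b ≤ t * suc m → m ∸ 1 ≤ 4 * t * a
≤-absorb-half {t} {a} {b} {m} 1≤t m≤ 2tb≤ = m≤n+o⇒m∸n≤o m 1 (+-cancelʳ-≤ m m (suc (4 * t * a)) m+m≤)
  where
  open ≤-Reasoning
  t[m+m]≤ : t * (m + m) ≤ t * (suc (4 * t * a) + m)
  t[m+m]≤ = begin
    t * (m + m)                            ≡⟨ solve (t ∷ m ∷ []) ⟩
    2 * t * m                              ≤⟨ *-monoʳ-≤ (2 * t) m≤ ⟩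
    2 * t * (2 * t * a + b)                ≡⟨ *-distribˡ-+ (2 * t) (2 * t * a) b ⟩
    2 * t * (2 * t * a) + 2 * t * b        ≤⟨ +-monoʳ-≤ (2 * t * (2 * t * a)) 2tb≤ ⟩
    2 * t * (2 * t * a) + t * suc m        ≡⟨ solve (t ∷ a ∷ m ∷ []) ⟩
    t * (suc (4 * t * a) + m)              ∎
  m+m≤ : m + m ≤ suc (4 * t * a) + m
  m+m≤ = *-cancelˡ-≤ t {{>-nonZero 1≤t}} t[m+m]≤

module _ {N t n : ℕ} {C : ℕ → Subset N} (E : Evolution t C n) where
  open Evolution E

  S-antitone : ∀ X {i j} → i ≤ j → j ≤ n → S j X ≡ true → S i X ≡ true
  S-antitone X {j = zero} z≤n _ X∈ = X∈
  S-antitone X {i} {suc j} i≤1+j 1+j≤n X∈ with m≤n⇒m<n∨m≡n i≤1+j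
  ... | inj₂ refl = X∈
  ... | inj₁ (s≤s i≤j) = S-antitone X i≤j (<⇒≤ 1+j≤n) (proj₁ (proj₁ (step j 1+j≤n X) X∈))

  friend-persists-or-dies : ∀ j X k → (∃ λ Y → F j X k ≡ just Y × S (suc j) Y ≡ true)
                                    ⊎ (∀ Y → F j X k ≡ just Y → S (suc j) Y ≡ false)
  friend-persists-or-dies j X k with F j X k
  ... | nothing = inj₂ λ _ ()
  ... | just Y with S (suc j) Y in S≡
  ...   | true  = inj₁ (Y , refl , S≡)
  ...   | false = inj₂ λ { _ refl → S≡ }

module Survivor {N t m : ℕ} {C : ℕ → Subset N} (E : Evolution t C (suc m))
                (1≤t : 1 ≤ t) (X : Subset N) (X∈Sₘ : Evolution.S E m X ≡ true) where
  open Evolution E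

  c : ℕ
  c = 2 * t

  alive : ∀ {l} → l ≤ m → S l X ≡ true
  alive l≤m = S-antitone E X l≤m (n≤1+n m) X∈Sₘ

  survives : ∀ {j} → suc j ≤ m → SurvivesTo S F C X j
  survives {j} j<m = proj₁ (step j (m≤n⇒m≤1+n j<m) X) (alive j<m)

  friendMeets : Fin t → ℕ → Bool
  friendMeets k zero    = false
  friendMeets k (suc l) = maybe′ (λ Y → meets? Y (C (suc l))) false (F l X k)

  hits : Fin t → ℕ → ℕ
  hits k = count (friendMeets k) 0

  friendMeets-just : ∀ {j k Y} → F j X k ≡ just Y → friendMeets k (suc j) ≡ meets? Y (C (suc j))
  friendMeets-just eq rewrite eq = refl

  friendMeets-nothing : ∀ {j k} → F j X k ≡ nothing → friendMeets k (suc j) ≡ false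
  friendMeets-nothing eq rewrite eq = refl

  potential : ℕ → ℕ
  potential j = c * Nα S C X 0 j + sum (λ k → hits k j)

  hits-≤-suc : ∀ k j → hits k j ≤ hits k (suc j)
  hits-≤-suc k = count-≤-suc (friendMeets k) 0

  potential-≤-suc : ∀ j → potential j ≤ potential (suc j)
  potential-≤-suc j =
    +-mono-≤ (*-monoʳ-≤ c (count-≤-suc _ 0 j)) (sum-mono-≤ (λ k → hits-≤-suc k j))

  potential-α : ∀ {j} → suc j ≤ m → Meets X (C (suc j)) → suc (potential j) ≤ potential (suc j)
  potential-α {j} j<m meets = begin
    suc (c * a + σ)           ≤⟨ +-monoˡ-≤ (c * a + σ) (≤-trans 1≤t (m≤n*m t 2)) ⟩
    c + (c * a + σ)           ≡⟨ sym (+-assoc c (c * a) σ) ⟩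
    c + c * a + σ             ≡⟨ cong (_+ σ) (sym (*-suc c a)) ⟩
    c * suc a + σ             ≡⟨ cong (λ x → c * x + σ) (sym Nα-suc) ⟩
    c * Nα S C X 0 (suc j) + σ ≤⟨ +-monoʳ-≤ _ (sum-mono-≤ (λ k → hits-≤-suc k j)) ⟩
    potential (suc j)         ∎
    where
    open ≤-Reasoning
    a = Nα S C X 0 j
    σ = sum (λ k → hits k j)
    Nα-suc : Nα S C X 0 (suc j) ≡ suc a
    Nα-suc = count-suc-true (λ l → S l X ∧ meets? X (C l)) z≤n
               (cong₂ _∧_ (alive j<m) (dec-true (nonempty? _) meets))

  potential-β : ∀ {j k Y} → F j X k ≡ just Y → Meets Y (C (suc j)) →
                suc (potential j) ≤ potential (suc j)
  potential-β {j} {k} F≡Y meets = begin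
    suc (c * a + σ)   ≡⟨ sym (+-suc (c * a) σ) ⟩
    c * a + suc σ     ≤⟨ +-mono-≤ (*-monoʳ-≤ c (count-≤-suc _ 0 j))
                                  (sum-mono-< (λ k → hits-≤-suc k j) k (≤-reflexive (sym hits-suc))) ⟩
    potential (suc j) ∎
    where
    open ≤-Reasoning
    a = Nα S C X 0 j
    σ = sum (λ k → hits k j)
    hits-suc : hits k (suc j) ≡ suc (hits k j)
    hits-suc = count-suc-true (friendMeets k) z≤n
                 (trans (friendMeets-just F≡Y) (dec-true (nonempty? _) meets))

  potential-split : ∀ {i j} → i ≤ j → potential i + c * Nα S C X i j ≤ potential j
  potential-split {i} {j} i≤j = begin
    c * Nα S C X 0 i + σ i + c * Nα S C X i j  ≡⟨ xy∙z≈xz∙y (c * Nα S C X 0 i) (σ i) _ ⟩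
    c * Nα S C X 0 i + c * Nα S C X i j + σ i  ≡⟨ cong (_+ σ i) (sym (*-distribˡ-+ c _ _)) ⟩
    c * (Nα S C X 0 i + Nα S C X i j) + σ i    ≡⟨ cong (λ x → c * x + σ i) (sym (count-split _ z≤n i≤j)) ⟩
    c * Nα S C X 0 j + σ i                     ≤⟨ +-monoʳ-≤ _ (sum-mono-≤ hits-mono) ⟩
    potential j                                ∎
    where
    open ≤-Reasoning
    hits-mono : ∀ k → hits k i ≤ hits k j
    hits-mono k = count-monoʳ (friendMeets k) 0 i≤j
    σ : ℕ → ℕ
    σ l = sum (λ k → hits k l)

  progress : ∀ j → j ≤ m → j ≤ potential j
  progress = <-rec (λ j → j ≤ m → j ≤ potential j) go
    where
    go : ∀ j → (∀ {i} → i < j → i ≤ m → i ≤ potential i) → j ≤ m → j ≤ potential j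
    go zero    _  _   = z≤n
    go (suc j) IH j<m with survives j<m
    ... | _ , inj₁ meets =
      ≤-trans (s≤s (IH ≤-refl (<⇒≤ j<m))) (potential-α j<m meets)
    ... | _ , inj₂ (inj₁ (k , Y , F≡Y , meets)) =
      ≤-trans (s≤s (IH ≤-refl (<⇒≤ j<m))) (potential-β F≡Y meets)
    ... | _ , inj₂ (inj₂ (i , i≤j , γ)) = begin
      suc j                              ≤⟨ m≤n+m∸n (suc j) i ⟩
      i + (suc j ∸ i)                    ≤⟨ +-mono-≤ (IH (s≤s i≤j) (≤-trans i≤j (<⇒≤ j<m))) (<⇒≤ γ) ⟩
      potential i + c * Nα S C X i j     ≤⟨ potential-split i≤j ⟩
      potential j                        ≤⟨ potential-≤-suc j ⟩
      potential (suc j)                  ∎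
      where open ≤-Reasoning

  credit : Maybe (Subset N) → ℕ → ℕ → ℕ
  credit nothing  s j = 0
  credit (just Y) s j = c * Nα S C Y s j

  -- From time s on, the hits through slot k are paid for by the α-steps of the current
  -- friend in it; a friend that drops out at j+1 made no γ-step, so its credit is ≤ j+1-s.
  Budget : Fin t → ℕ → Set
  Budget k j = ∃ λ s → s ≤ j × c * hits k j ≤ s + credit (F j X k) s j

  budget-restart : ∀ {k j} → c * hits k j ≤ j → Budget k j
  budget-restart {k} {j} bound = j , ≤-refl , subst (c * hits k j ≤_) (sym j+credit≡j) bound
    where
    credit-empty : ∀ mY → credit mY j j ≡ 0
    credit-empty nothing  = refl
    credit-empty (just Y) = trans (cong (c *_) (count-empty _ j ≤-refl)) (*-zeroʳ c)
    j+credit≡j : j + credit (F j X k) j j ≡ j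
    j+credit≡j = trans (cong (j +_) (credit-empty (F j X k))) (+-identityʳ j)

  budget-closes : ∀ {j k} → j ≤ m → Budget k j → (∀ Y → F j X k ≡ just Y → S (suc j) Y ≡ false) →
                  c * hits k (suc j) ≤ suc j
  budget-closes {j} {k} j≤m (s , s≤j , bound) dies = closes (F j X k) refl
    where
    open ≤-Reasoning
    bound-for : ∀ {mY} → F j X k ≡ mY → c * hits k j ≤ s + credit mY s j
    bound-for F≡ = subst (λ mY → c * hits k j ≤ s + credit mY s j) F≡ bound
    closes : ∀ mY → F j X k ≡ mY → c * hits k (suc j) ≤ suc j
    closes nothing F≡ = begin
      c * hits k (suc j)   ≡⟨ cong (c *_) (count-suc-false (friendMeets k) j (friendMeets-nothing F≡)) ⟩
      c * hits k j         ≤⟨ bound-for F≡ ⟩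
      s + 0                ≡⟨ +-identityʳ s ⟩
      s                    ≤⟨ m≤n⇒m≤1+n s≤j ⟩
      suc j                ∎
    closes (just Y) F≡ = begin
      c * hits k (suc j)   ≡⟨ cong (c *_) (count-suc-false (friendMeets k) j hit≡false) ⟩
      c * hits k j         ≤⟨ bound-for F≡ ⟩
      s + c * Nα S C Y s j ≤⟨ +-monoʳ-≤ s (≮⇒≥ ¬γ) ⟩
      s + (suc j ∸ s)      ≡⟨ m+[n∸m]≡n (m≤n⇒m≤1+n s≤j) ⟩
      suc j                ∎
      where
      Y∈Sⱼ : S j Y ≡ true
      Y∈Sⱼ = society j (m≤n⇒m≤1+n j≤m) X k Y (alive j≤m) F≡
      ¬survives : ¬ SurvivesTo S F C Y j
      ¬survives survival = case trans (sym (proj₂ (step j (s≤s j≤m) Y) survival)) (dies Y F≡) of λ ()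
      hit≡false : friendMeets k (suc j) ≡ false
      hit≡false = trans (friendMeets-just F≡)
                    (dec-false (nonempty? _) (λ meets → ¬survives (Y∈Sⱼ , inj₁ meets)))
      ¬γ : ¬ (suc j ∸ s < c * Nα S C Y s j)
      ¬γ γ = ¬survives (Y∈Sⱼ , inj₂ (inj₂ (s , s≤j , γ)))

  budget-keeps : ∀ {j k Y} → suc j ≤ m → Budget k j → F j X k ≡ just Y → S (suc j) Y ≡ true →
                 Budget k (suc j)
  budget-keeps {j} {k} {Y} j<m (s , s≤j , bound) F≡ Y∈ =
    s , m≤n⇒m≤1+n s≤j ,
    subst (λ mY → c * hits k (suc j) ≤ s + credit mY s (suc j)) (sym F′≡) (by-cases (nonempty? _))
    where
    F′≡ : F (suc j) X k ≡ just Y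
    F′≡ = permanent j (m≤n⇒m≤1+n j<m) X k Y F≡ (alive j<m) Y∈
    bound′ : c * hits k j ≤ s + c * Nα S C Y s j
    bound′ = subst (λ mY → c * hits k j ≤ s + credit mY s j) F≡ bound
    by-cases : Dec (Meets Y (C (suc j))) → c * hits k (suc j) ≤ s + c * Nα S C Y s (suc j)
    by-cases (yes meets) = begin
      c * hits k (suc j)             ≡⟨ cong (c *_) (count-suc-true (friendMeets k) z≤n hit) ⟩
      c * suc (hits k j)             ≡⟨ *-suc c (hits k j) ⟩
      c + c * hits k j               ≤⟨ +-monoʳ-≤ c bound′ ⟩
      c + (s + c * Nα S C Y s j)     ≡⟨ x∙yz≈y∙xz c s _ ⟩
      s + (c + c * Nα S C Y s j)     ≡⟨ cong (s +_) (sym (*-suc c _)) ⟩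
      s + c * suc (Nα S C Y s j)     ≡⟨ cong (λ x → s + c * x) (sym (count-suc-true _ s≤j αY)) ⟩
      s + c * Nα S C Y s (suc j)     ∎
      where
      open ≤-Reasoning
      hit = trans (friendMeets-just F≡) (dec-true (nonempty? _) meets)
      αY = cong₂ _∧_ Y∈ (dec-true (nonempty? _) meets)
    by-cases (no ¬meets) = begin
      c * hits k (suc j)             ≡⟨ cong (c *_) (count-suc-false (friendMeets k) j hit) ⟩
      c * hits k j                   ≤⟨ bound′ ⟩
      s + c * Nα S C Y s j           ≡⟨ cong (λ x → s + c * x) (sym (count-suc-false _ j αY)) ⟩
      s + c * Nα S C Y s (suc j)     ∎
      where
      open ≤-Reasoning
      hit = trans (friendMeets-just F≡) (dec-false (nonempty? _) ¬meets)
      αY = cong₂ _∧_ Y∈ (dec-false (nonempty? _) ¬meets)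

  budget-step : ∀ {j} k → suc j ≤ m → Budget k j → Budget k (suc j)
  budget-step {j} k j<m budget with friend-persists-or-dies E j X k
  ... | inj₁ (Y , F≡ , Y∈) = budget-keeps j<m budget F≡ Y∈
  ... | inj₂ dies          = budget-restart (budget-closes (<⇒≤ j<m) budget dies)

  budget : ∀ k {j} → j ≤ m → Budget k j
  budget k {zero}  _   = budget-restart (≤-reflexive (*-zeroʳ c))
  budget k {suc j} j<m = budget-step k j<m (budget k (<⇒≤ j<m))

  hits-bound : ∀ k → c * hits k m ≤ suc m
  hits-bound k = ≤-trans (*-monoʳ-≤ c (hits-≤-suc k m))
                         (budget-closes ≤-refl (budget k ≤-refl) (λ Y _ → last-empty Y))

  hits-sum-bound : c * sum (λ k → hits k m) ≤ t * suc m
  hits-sum-bound = begin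
    c * sum (λ k → hits k m)   ≡⟨ *-distribˡ-sum c (λ k → hits k m) ⟩
    sum (λ k → c * hits k m)   ≤⟨ sum-≤-const (suc m) hits-bound ⟩
    t * suc m                  ∎
    where open ≤-Reasoning

lemma4 : ∀ {N : ℕ} (_≼_ : Rel (Fin N) 0ℓ) → IsPartialOrder _≡_ _≼_ →
         (P : FirstFitPartition _≼_) →
         ∀ (t : ℕ) → 1 ≤ t → ∀ (n : ℕ) →
         (E : Evolution t (FirstFitPartition.C P) n) →
         ∀ (X : Subset N) → Evolution.S E (n ∸ 1) X ≡ true →
         n ∸ 2 ≤ 4 * t * ∣ X ∣
lemma4 _ _ P t 1≤t zero    E X _   = z≤n
lemma4 _ _ P t 1≤t (suc m) E X X∈Sₘ =
  ≤-trans (≤-absorb-half 1≤t (progress m ≤-refl) hits-sum-bound)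
          (*-monoʳ-≤ (4 * t) (Nα≤∣∣ C C-disjoint X (Evolution.S E) m))
  where
  open FirstFitPartition P using (C; C-disjoint)
  open Survivor E 1≤t X X∈Sₘ
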